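{- Let $G$ be a bipartite graph with no star cutset. Let $(X_1,X_2,A_1,\ldots,A_6)$ be a split of a $6$-join of $G$, and let $G_1,G_2$ be the corresponding blocks of decomposition. Then: (i) $X_1\setminus(A_1\cup A_3\cup A_5)\ne\emptyset$ and $X_2\setminus(A_2\cup A_4\cup A_6)\ne\emptyset$; (ii) if $C$ is a connected component of $G[X_1\setminus(A_1\cup A_3\cup A_5)]$ (resp. of $G[X_2\setminus(A_2\cup A_4\cup A_6)]$), then for every $i\in\{1,3,5\}$ (resp. $i\in\{2,4,6\}$) some vertex of $A_i$ has a neighbor in $C$; (iii) if $G$ is $4$-hole-free or $\Delta(G)\le 3$, then $|A_i|=1$ for every $i\in\{1,\ldots,6\}$, and in particular every vertex of $\bigcup_{i=1}^6 A_i$ has degree at least $3$ in $G$; (iv) if $G$ is balanceable, then so are $G_1$ and $G_2$; (v) if $G$ is $4$-hole-free, then $G_1$ and $G_2$ have no star cutset.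
   Context: A star cutset of $G$ is a pair $(x,R)$ with $x\in V(G)$, $R\subseteq N(x)$, and $G\setminus(\{x\}\cup R)$ disconnected. A $6$-join of $G$ with split $(X_1,X_2,A_1,\ldots,A_6)$: $(X_1,X_2)$ is a partition of $V(G)$, $X_1$ contains pairwise disjoint nonempty sets $A_1,A_3,A_5$, $X_2$ contains pairwise disjoint nonempty sets $A_2,A_4,A_6$, for each $i$ every vertex of $A_i$ is adjacent to every vertex of $A_{i-1}\cup A_{i+1}$ (indices mod $6$), these are the only edges between $X_1$ and $X_2$, and $|X_1|\ge 4$, $|X_2|\ge 4$. The blocks of decomposition: choose any $a_i\in A_i$ for $i=1,\dots,6$; then $G_1=G[X_1\cup\{a_2,a_4,a_6\}]$ and $G_2=G[X_2\cup\{a_1,a_3,a_5\}]$. A hole is a chordless cycle of length at least $4$; $4$-hole-free means no induced cycle of length $4$. A bipartite graph is balanceable if its edges can be assigned weights $\pm1$ so that every hole has total weight $\equiv 0\pmod 4$. -}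

module Defs where

open import Data.Nat using (ℕ; zero; suc; _≤_)
open import Data.Nat.DivMod using (_mod_)
open import Data.Bool using (Bool; true; false)
open import Data.Fin using (Fin; toℕ)
open import Data.Fin.Subset using (Subset; _∈_; _∉_; _⊆_; _∪_; _─_; ⁅_⁆; ∣_∣; Nonempty; Empty; _∩_)
open import Data.Vec using (tabulate)
open import Data.Integer using (ℤ; +_; -_) renaming (_+_ to _+ℤ_)
open import Data.Integer.Divisibility using () renaming (_∣_ to _∣ℤ_)
open import Data.Product using (Σ; ∃; _×_; _,_)
open import Data.Sum using (_⊎_)
open import Relation.Nullary using (¬_)
open import Relation.Binary.PropositionalEquality using (_≡_; _≢_)
open import Function.Bundles using (_⇔_)
open import Function.Definitions using (Injective)

record Graph (n : ℕ) : Set where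
  field
    adj    : Fin n → Fin n → Bool
    sym    : ∀ u v → adj u v ≡ adj v u
    irrefl : ∀ v → adj v v ≡ false

module _ {n : ℕ} (G : Graph n) where
  open Graph G

  E : Fin n → Fin n → Set
  E u v = adj u v ≡ true

  N : Fin n → Subset n
  N v = tabulate (adj v)

  deg : Fin n → ℕ
  deg v = ∣ N v ∣

  MaxDeg≤ : ℕ → Set
  MaxDeg≤ d = ∀ v → deg v ≤ d

  Bipartite : Set
  Bipartite = Σ (Fin n → Bool) λ col → ∀ u v → E u v → col u ≢ col v

  data Reach (S : Subset n) : Fin n → Fin n → Set where
    here : ∀ {u} → u ∈ S → Reach S u u
    step : ∀ {u v w} → Reach S u v → E v w → w ∈ S → Reach S u w

  Disconnected : Subset n → Set
  Disconnected T = Σ (Fin n) λ u → Σ (Fin n) λ v →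
    u ∈ T × v ∈ T × ¬ Reach T u v

  record IsComponent (S C : Subset n) : Set where
    field
      sub       : C ⊆ S
      nonempty  : Nonempty C
      connected : ∀ u v → u ∈ C → v ∈ C → Reach S u v
      closed    : ∀ u v → u ∈ C → Reach S u v → v ∈ C

  StarCutset : Subset n → Fin n → Subset n → Set
  StarCutset S x R =
    x ∈ S × R ⊆ S × (∀ r → r ∈ R → E x r) × Disconnected (S ─ (⁅ x ⁆ ∪ R))

  NoStarCutset : Subset n → Set
  NoStarCutset S = ¬ (Σ (Fin n) λ x → Σ (Subset n) λ R → StarCutset S x R)

  cycSuc : ∀ {k} → Fin k → Fin k
  cycSuc {suc k} i = suc (toℕ i) mod suc k

  record IsHole (S : Subset n) (k : ℕ) (c : Fin k → Fin n) : Set where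
    field
      length≥4 : 4 ≤ k
      inj      : Injective _≡_ _≡_ c
      inS      : ∀ i → c i ∈ S
      chordless : ∀ i j → E (c i) (c j) ⇔ (j ≡ cycSuc i ⊎ i ≡ cycSuc j)

  FourHoleFree : Subset n → Set
  FourHoleFree S = ∀ c → ¬ IsHole S 4 c

sumℤ : ∀ {k} → (Fin k → ℤ) → ℤ
sumℤ {zero} f = + 0
sumℤ {suc k} f = f Fin.zero +ℤ sumℤ (λ i → f (Fin.suc i))

module _ {n : ℕ} (G : Graph n) where

  Balanceable : Subset n → Set
  Balanceable S = Σ (Fin n → Fin n → ℤ) λ w →
    (∀ u v → u ∈ S → v ∈ S → E G u v →
        w u v ≡ w v u × (w u v ≡ + 1 ⊎ w u v ≡ - (+ 1)))
    × (∀ k c → IsHole G S k c →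
        (+ 4) ∣ℤ sumℤ (λ i → w (c i) (c (cycSuc G i))))

  record SixJoin : Set where
    field
      X₁ X₂ A₁ A₂ A₃ A₄ A₅ A₆ : Subset n
      cover    : ∀ v → v ∈ X₁ ⊎ v ∈ X₂
      disj     : ∀ v → v ∈ X₁ → v ∉ X₂
      A₁⊆ : A₁ ⊆ X₁
      A₃⊆ : A₃ ⊆ X₁
      A₅⊆ : A₅ ⊆ X₁
      A₂⊆ : A₂ ⊆ X₂
      A₄⊆ : A₄ ⊆ X₂
      A₆⊆ : A₆ ⊆ X₂
      ne₁ : Nonempty A₁
      ne₂ : Nonempty A₂
      ne₃ : Nonempty A₃
      ne₄ : Nonempty A₄
      ne₅ : Nonempty A₅
      ne₆ : Nonempty A₆
      d₁₃ : Empty (A₁ ∩ A₃)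
      d₁₅ : Empty (A₁ ∩ A₅)
      d₃₅ : Empty (A₃ ∩ A₅)
      d₂₄ : Empty (A₂ ∩ A₄)
      d₂₆ : Empty (A₂ ∩ A₆)
      d₄₆ : Empty (A₄ ∩ A₆)
      c₁₂ : ∀ u v → u ∈ A₁ → v ∈ A₂ → E G u v
      c₂₃ : ∀ u v → u ∈ A₂ → v ∈ A₃ → E G u v
      c₃₄ : ∀ u v → u ∈ A₃ → v ∈ A₄ → E G u v
      c₄₅ : ∀ u v → u ∈ A₄ → v ∈ A₅ → E G u v
      c₅₆ : ∀ u v → u ∈ A₅ → v ∈ A₆ → E G u v
      c₆₁ : ∀ u v → u ∈ A₆ → v ∈ A₁ → E G u v
      only : ∀ u v → u ∈ X₁ → v ∈ X₂ → E G u v →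
        (u ∈ A₁ × (v ∈ A₂ ⊎ v ∈ A₆))
        ⊎ (u ∈ A₃ × (v ∈ A₂ ⊎ v ∈ A₄))
        ⊎ (u ∈ A₅ × (v ∈ A₄ ⊎ v ∈ A₆))
      size₁ : 4 ≤ ∣ X₁ ∣
      size₂ : 4 ≤ ∣ X₂ ∣

  Singleton : Subset n → Set
  Singleton A = ∣ A ∣ ≡ 1

  -- block G₁ = G[X₁ ∪ {a₂, a₄, a₆}] and G₂ = G[X₂ ∪ {a₁, a₃, a₅}]
  block : Subset n → Fin n → Fin n → Fin n → Subset n
  block X a b c = X ∪ ⁅ a ⁆ ∪ ⁅ b ⁆ ∪ ⁅ c ⁆

-- Bipartiteness makes A₁ ∪ A₃ ∪ A₅ stable, and the absence of star cutsets is used through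
-- three kinds of star. The star at a₄ ∈ A₄ with leaves A₃ ∪ A₅ cannot separate a vertex of
-- Y₁ from a₁, so every component of Y₁ sees A₁ (ii). The star at u ∈ A₁ with leaves N(u)
-- shows that no vertex u′ ≠ u has N(u′) ⊆ N(u); if Y₁ were empty this would hold for any two
-- vertices of A₁, giving |X₁| ≤ 3 (i). Two vertices of A₁ span a 4-hole with a₂ and a₆, and
-- if Δ ≤ 3 a vertex of A₆ with a neighbour in Y₂ would have degree 4 (iii). Holes of an
-- induced subgraph are holes of G (iv). A star cutset of a block would be one of G: a path of
-- G avoiding the star leaves and re-enters the block only through a₂, a₄, a₆, and any two of
-- these are joined around the hexagon a₂ a₃ a₄ a₅ a₆ a₁, since in a bipartite 4-hole-free
-- graph a closed neighbourhood cannot contain two vertices at distance two of the hexagon, nor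
-- both ends of a non-adjacent opposite pair (v). By rotating the join, each statement is
-- proved only for A₁.

module Submission where

open import Defs
open import Data.Bool using (Bool; true) renaming (_≟_ to _≟ᵇ_)
open import Data.Bool.Properties using (¬-not)
open import Data.Empty using (⊥; ⊥-elim)
open import Data.Fin using (Fin) renaming (_≟_ to _≟ᶠ_)
open import Data.Fin.Patterns using (0F; 1F; 2F; 3F)
open import Data.Fin.Properties using (any?)
open import Data.Fin.Subset
  using (Subset; ⊤; _∈_; _∉_; _⊆_; _∪_; _∩_; _─_; _-_; ⁅_⁆; ∣_∣; Nonempty; Empty; inside; outside)
open import Data.Fin.Subset.Properties
  using ( _∈?_; ∈⊤; x∈p∪q⁺; x∈p∪q⁻; x∈p∩q⁺; p─q⊆p; x∈p∧x∉q⇒x∈p─q; x∈p∧x≢y⇒x∈p-y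
        ; x∈⁅x⁆; x∈⁅y⁆⇒x≡y; x≢y⇒x∉⁅y⁆; x∉⁅y⁆⇒x≢y; ⊆-antisym; ∣⁅x⁆∣≡1
        ; p⊆q⇒∣p∣≤∣q∣; x∈p⇒∣p-x∣<∣p∣; ∪-comm; ∪-assoc; ∩-comm; nonempty?)
open import Data.List using (List; []; _∷_; length)
open import Data.List.Relation.Unary.All as All using (All; []; _∷_)
open import Data.List.Relation.Unary.AllPairs using ([]; _∷_)
open import Data.List.Relation.Unary.Unique.Propositional using (Unique)
open import Data.Nat using (ℕ; zero; suc; _≤_; _+_; z≤n; s≤s)
open import Data.Nat.Properties
  using (≤-refl; ≤-trans; ≤-reflexive; +-monoʳ-≤; n≤1+n; +-suc; <⇒≱; module ≤-Reasoning)
open import Data.Product using (Σ; _×_; _,_; proj₁; proj₂)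
open import Data.Vec using ([]; _∷_; here; there)
open import Data.Vec.Properties using (lookup⇒[]=; []=⇒lookup; lookup∘tabulate)
open import Data.Sum using (_⊎_; inj₁; inj₂; [_,_]′; swap)
open import Function using (id; _∘_)
open import Function.Bundles using (_⇔_; mk⇔)
open import Relation.Nullary using (¬_; Dec; yes; no)
open import Relation.Nullary.Decidable using (decidable-stable; _×-dec_)
open import Relation.Binary.PropositionalEquality
  using (_≡_; _≢_; ≢-sym; refl; sym; trans; cong; cong₂; subst)

private
  variable
    n : ℕ
    x y : Fin n
    p q r : Subset n

x∈p─q⇒x∉q : x ∈ p ─ q → x ∉ q
x∈p─q⇒x∉q {p = _ ∷ _} {q = outside ∷ _} here ()
x∈p─q⇒x∉q {p = _ ∷ _} {q = inside ∷ _} () here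
x∈p─q⇒x∉q {p = _ ∷ _} {q = _ ∷ _} (there x∈) (there x∈q) = x∈p─q⇒x∉q x∈ x∈q

x∈p∧x∉p─q⇒x∈q : x ∈ p → x ∉ p ─ q → x ∈ q
x∈p∧x∉p─q⇒x∈q {x = x} {q = q} x∈p x∉p─q =
  decidable-stable (x ∈? q) (x∉p─q ∘ x∈p∧x∉q⇒x∈p─q x∈p)

x∈p∧x∈q─r⇒x∈p─r : x ∈ p → x ∈ q ─ r → x ∈ p ─ r
x∈p∧x∈q─r⇒x∈p─r x∈p x∈q─r = x∈p∧x∉q⇒x∈p─q x∈p (x∈p─q⇒x∉q x∈q─r)

x∈p─q∪r⁺ : x ∈ p → x ∉ q → x ∉ r → x ∈ p ─ (q ∪ r)
x∈p─q∪r⁺ x∈p x∉q x∉r = x∈p∧x∉q⇒x∈p─q x∈p ([ x∉q , x∉r ]′ ∘ x∈p∪q⁻ _ _)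

x∈p─q∪r⇒x∉q : x ∈ p ─ (q ∪ r) → x ∉ q
x∈p─q∪r⇒x∉q x∈ = x∈p─q⇒x∉q x∈ ∘ x∈p∪q⁺ ∘ inj₁

x∈p─q∪r⇒x∉r : x ∈ p ─ (q ∪ r) → x ∉ r
x∈p─q∪r⇒x∉r x∈ = x∈p─q⇒x∉q x∈ ∘ x∈p∪q⁺ ∘ inj₂

∪-elim : ∀ {a} {A : Set a} → (x ∈ p → A) → (x ∈ q → A) → x ∈ p ∪ q → A
∪-elim f g = [ f , g ]′ ∘ x∈p∪q⁻ _ _

disjoint⇒∉ : Empty (p ∩ q) → x ∈ p → x ∉ q
disjoint⇒∉ p∩q-empty x∈p x∈q = p∩q-empty (_ , x∈p∩q⁺ (x∈p , x∈q))

disjoint⇒≢ : Empty (p ∩ q) → x ∈ p → y ∈ q → x ≢ y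
disjoint⇒≢ p∩q-empty x∈p y∈q refl = disjoint⇒∉ p∩q-empty x∈p y∈q

∪-rotate : (p q r : Subset n) → p ∪ q ∪ r ≡ q ∪ r ∪ p
∪-rotate p q r = trans (∪-comm p (q ∪ r)) (∪-assoc q r p)

∣p∪q∣≤∣p∣+∣q∣ : (p q : Subset n) → ∣ p ∪ q ∣ ≤ ∣ p ∣ + ∣ q ∣
∣p∪q∣≤∣p∣+∣q∣ []            []            = z≤n
∣p∪q∣≤∣p∣+∣q∣ (inside ∷ p)  (inside ∷ q)  =
  s≤s (≤-trans (∣p∪q∣≤∣p∣+∣q∣ p q) (+-monoʳ-≤ ∣ p ∣ (n≤1+n ∣ q ∣)))
∣p∪q∣≤∣p∣+∣q∣ (inside ∷ p)  (outside ∷ q) = s≤s (∣p∪q∣≤∣p∣+∣q∣ p q)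
∣p∪q∣≤∣p∣+∣q∣ (outside ∷ p) (inside ∷ q)  =
  ≤-trans (s≤s (∣p∪q∣≤∣p∣+∣q∣ p q)) (≤-reflexive (sym (+-suc ∣ p ∣ ∣ q ∣)))
∣p∪q∣≤∣p∣+∣q∣ (outside ∷ p) (outside ∷ q) = ∣p∪q∣≤∣p∣+∣q∣ p q

AtMostOne : Subset n → Set
AtMostOne p = ∀ {x y} → x ∈ p → y ∈ p → x ≡ y

nonempty∧atMostOne⇒∣p∣≡1 : Nonempty p → AtMostOne p → ∣ p ∣ ≡ 1
nonempty∧atMostOne⇒∣p∣≡1 {p = p} (x , x∈p) atMostOne =
  trans (cong ∣_∣ (⊆-antisym p⊆⁅x⁆ ⁅x⁆⊆p)) (∣⁅x⁆∣≡1 x)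
  where
  p⊆⁅x⁆ : p ⊆ ⁅ x ⁆
  p⊆⁅x⁆ y∈p = subst (_∈ ⁅ x ⁆) (atMostOne x∈p y∈p) (x∈⁅x⁆ x)
  ⁅x⁆⊆p : ⁅ x ⁆ ⊆ p
  ⁅x⁆⊆p y∈⁅x⁆ = subst (_∈ p) (sym (x∈⁅y⁆⇒x≡y x y∈⁅x⁆)) x∈p

Unique∧All∈⇒length≤∣p∣ : {xs : List (Fin n)} → Unique xs → All (_∈ p) xs → length xs ≤ ∣ p ∣
Unique∧All∈⇒length≤∣p∣ []                  []            = z≤n
Unique∧All∈⇒length≤∣p∣ {p = p} {xs = x ∷ xs} (x≢xs ∷ unique-xs) (x∈p ∷ xs⊆p) =
  ≤-trans (s≤s (Unique∧All∈⇒length≤∣p∣ unique-xs xs⊆p-x)) (x∈p⇒∣p-x∣<∣p∣ x∈p)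
  where
  xs⊆p-x : All (_∈ p - x) xs
  xs⊆p-x = All.zipWith (λ (y∈p , x≢y) → x∈p∧x≢y⇒x∈p-y y∈p (x≢y ∘ sym)) (xs⊆p , x≢xs)

square : Fin n → Fin n → Fin n → Fin n → Fin 4 → Fin n
square a b c d 0F = a
square a b c d 1F = b
square a b c d 2F = c
square a b c d 3F = d

module _ {n} (G : Graph n) where

  private
    variable
      a b c d u u′ v w w′ : Fin n
      R S T Y Z : Subset n

  E-sym : E G u v → E G v u
  E-sym {u} {v} = trans (Graph.sym G v u)

  E-irrefl : E G u v → u ≢ v
  E-irrefl {u} uu refl with trans (sym uu) (Graph.irrefl G u)
  ... | ()

  E? : ∀ u v → Dec (E G u v)
  E? u v = Graph.adj G u v ≟ᵇ true

  E⇒∈N : E G u v → v ∈ N G u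
  E⇒∈N {u} {v} uv = lookup⇒[]= v (N G u) (trans (lookup∘tabulate (Graph.adj G u) v) uv)

  ∈N⇒E : v ∈ N G u → E G u v
  ∈N⇒E {v} {u} v∈N = trans (sym (lookup∘tabulate (Graph.adj G u) v)) ([]=⇒lookup v∈N)

  HasNbr : Subset n → Subset n → Set
  HasNbr A C = Σ (Fin n) λ a → Σ (Fin n) λ c → a ∈ A × c ∈ C × E G a c

  HasNbr? : ∀ A C → Dec (HasNbr A C)
  HasNbr? A C = any? λ a → any? λ c → a ∈? A ×-dec (c ∈? C ×-dec E? a c)

  Reach-target : Reach G S u v → v ∈ S
  Reach-target (here v∈S)     = v∈S
  Reach-target (step _ _ v∈S) = v∈S

  Reach-prepend : u ∈ S → E G u v → Reach G S v w → Reach G S u w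
  Reach-prepend u∈S uv (here v∈S)        = step (here u∈S) uv v∈S
  Reach-prepend u∈S uv (step path e w∈S) = step (Reach-prepend u∈S uv path) e w∈S

  Reach-sym : Reach G S u v → Reach G S v u
  Reach-sym (here u∈S)        = here u∈S
  Reach-sym (step path e v∈S) = Reach-prepend v∈S (E-sym e) (Reach-sym path)

  Reach-trans : Reach G S u v → Reach G S v w → Reach G S u w
  Reach-trans path (here _)           = path
  Reach-trans path (step path′ e w∈S) = step (Reach-trans path path′) e w∈S

  Exit : Subset n → Subset n → Fin n → Set
  Exit T Y u = Σ (Fin n) λ c → Σ (Fin n) λ w → Reach G Y u c × E G c w × w ∈ T × w ∉ Y

  Reach-stays-or-exits : Reach G T u v → u ∈ Y → Reach G Y u v ⊎ Exit T Y u
  Reach-stays-or-exits (here _) u∈Y = inj₁ (here u∈Y)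
  Reach-stays-or-exits {Y = Y} (step {w = w} path e w∈T) u∈Y
    with Reach-stays-or-exits path u∈Y | w ∈? Y
  ... | inj₁ inside-Y | yes w∈Y = inj₁ (step inside-Y e w∈Y)
  ... | inj₁ inside-Y | no w∉Y  = inj₂ (_ , w , inside-Y , e , w∈T , w∉Y)
  ... | inj₂ exit     | _       = inj₂ exit

  Reach-exits : Reach G T u v → u ∈ Y → v ∉ Y → Exit T Y u
  Reach-exits path u∈Y v∉Y =
    [ ⊥-elim ∘ v∉Y ∘ Reach-target , id ]′ (Reach-stays-or-exits path u∈Y)

  -- A walk of G − Z that leaves S does so, and comes back, through Q; the second hypothesis
  -- reconnects the pieces inside S.
  Reach-restrict : {Q : Subset n} →
    (∀ {w w′} → w ∈ S → w′ ∉ S → E G w w′ → w ∈ Q) →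
    (∀ {q q′} → q ∈ Q → q′ ∈ Q → q ∈ S ─ Z → q′ ∈ S ─ Z → Reach G (S ─ Z) q q′) →
    Reach G (⊤ ─ Z) u v → u ∈ S ─ Z → v ∈ S → Reach G (S ─ Z) u v
  Reach-restrict {S = S} {Z = Z} {u = u} {Q = Q} leave gates path u∈ v∈S with walk path
    where
    walk : Reach G (⊤ ─ Z) u w →
      (w ∈ S × Reach G (S ─ Z) u w) ⊎ (w ∉ S × Σ (Fin n) λ q → q ∈ Q × Reach G (S ─ Z) u q)
    walk (here _) = inj₁ (p─q⊆p S Z u∈ , here u∈)
    walk (step {v = w} {w = w′} path e w′∈) with walk path | w′ ∈? S
    ... | inj₁ (_ , in-S)             | yes w′∈S = inj₁ (w′∈S , step in-S e (x∈p∧x∈q─r⇒x∈p─r w′∈S w′∈))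
    ... | inj₁ (w∈S , in-S)           | no w′∉S  = inj₂ (w′∉S , w , leave w∈S w′∉S e , in-S)
    ... | inj₂ (_ , via-Q)            | no w′∉S  = inj₂ (w′∉S , via-Q)
    ... | inj₂ (w∉S , q , q∈Q , u⇝q) | yes w′∈S = inj₁ (w′∈S , Reach-trans u⇝q q⇝w′)
      where
      q⇝w′ : Reach G (S ─ Z) q w′
      q⇝w′ = gates q∈Q (leave w′∈S w∉S (E-sym e)) (Reach-target u⇝q) (x∈p∧x∈q─r⇒x∈p─r w′∈S w′∈)
  ... | inj₁ (_ , in-S) = in-S
  ... | inj₂ (v∉S , _)  = ⊥-elim (v∉S v∈S)

  IsHole-⊤ : ∀ {k h} → IsHole G S k h → IsHole G ⊤ k h
  IsHole-⊤ hole = record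
    { length≥4 = length≥4 ; inj = inj ; inS = λ _ → ∈⊤ ; chordless = chordless }
    where open IsHole hole

  Balanceable-restrict : Balanceable G ⊤ → Balanceable G S
  Balanceable-restrict (weight , ±1 , holes-≡0) =
    weight , (λ u v _ _ → ±1 u v ∈⊤ ∈⊤) , (λ k h → holes-≡0 k h ∘ IsHole-⊤)

  module _ (noCut : NoStarCutset G ⊤) where

    star-nonseparating : ∀ x R → (∀ r → r ∈ R → E G x r) →
      u ∈ ⊤ ─ (⁅ x ⁆ ∪ R) → v ∈ ⊤ ─ (⁅ x ⁆ ∪ R) → ¬ ¬ Reach G (⊤ ─ (⁅ x ⁆ ∪ R)) u v
    star-nonseparating {u} {v} x R x-R u∈ v∈ ¬u⇝v =
      noCut (x , R , ∈⊤ , (λ _ → ∈⊤) , x-R , u , v , u∈ , v∈ , ¬u⇝v)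

    -- The star of u with R = N(u) would separate u′ from w.
    dominated⇒adjacent : u ≢ u′ → (∀ {z} → E G u′ z → E G u z) → w ≢ u → w ≢ u′ → E G u w
    dominated⇒adjacent {u} {u′} {w} u≢u′ dominated w≢u w≢u′ =
      decidable-stable (E? u w) λ ¬uw →
        star-nonseparating u (N G u) (λ _ → ∈N⇒E) (u′∈ ¬uw) (w∈ ¬uw) λ u′⇝w →
          let (c , z , u′⇝c , cz , z∈ , _) = Reach-exits u′⇝w (x∈⁅x⁆ u′) (x≢y⇒x∉⁅y⁆ w≢u′)
              c≡u′ = x∈⁅y⁆⇒x≡y u′ (Reach-target u′⇝c)
          in x∈p─q∪r⇒x∉r z∈ (E⇒∈N (dominated (subst (λ c → E G c z) c≡u′ cz)))
      where
      u′∈ : ¬ E G u w → u′ ∈ ⊤ ─ (⁅ u ⁆ ∪ N G u)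
      u′∈ _ = x∈p─q∪r⁺ ∈⊤ (x≢y⇒x∉⁅y⁆ (u≢u′ ∘ sym))
                (λ u′∈N → E-irrefl (dominated (E-sym (∈N⇒E u′∈N))) refl)
      w∈ : ¬ E G u w → w ∈ ⊤ ─ (⁅ u ⁆ ∪ N G u)
      w∈ ¬uw = x∈p─q∪r⁺ ∈⊤ (x≢y⇒x∉⁅y⁆ w≢u) (¬uw ∘ ∈N⇒E)

  _∈N[_] : Fin n → Fin n → Set
  v ∈N[ x ] = v ≡ x ⊎ E G x v

  removed-by-star : (∀ r → r ∈ R → E G x r) → v ∈ S → v ∉ S ─ (⁅ x ⁆ ∪ R) → v ∈N[ x ]
  removed-by-star {R} {x} {v} x-R v∈S v∉ with v ≟ᶠ x | v ∈? R
  ... | yes v≡x | _       = inj₁ v≡x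
  ... | no _    | yes v∈R = inj₂ (x-R v v∈R)
  ... | no v≢x  | no v∉R  = ⊥-elim (v∉ (x∈p─q∪r⁺ v∈S (x≢y⇒x∉⁅y⁆ v≢x) v∉R))

  shift : SixJoin G → SixJoin G
  shift J = record
    { X₁ = X₂ ; X₂ = X₁ ; A₁ = A₆ ; A₂ = A₁ ; A₃ = A₂ ; A₄ = A₃ ; A₅ = A₄ ; A₆ = A₅
    ; cover = swap ∘ cover ; disj = λ v v∈X₂ v∈X₁ → disj v v∈X₁ v∈X₂
    ; A₁⊆ = A₆⊆ ; A₃⊆ = A₂⊆ ; A₅⊆ = A₄⊆ ; A₂⊆ = A₁⊆ ; A₄⊆ = A₃⊆ ; A₆⊆ = A₅⊆
    ; ne₁ = ne₆ ; ne₂ = ne₁ ; ne₃ = ne₂ ; ne₄ = ne₃ ; ne₅ = ne₄ ; ne₆ = ne₅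
    ; d₁₃ = subst Empty (∩-comm A₂ A₆) d₂₆ ; d₁₅ = subst Empty (∩-comm A₄ A₆) d₄₆ ; d₃₅ = d₂₄
    ; d₂₄ = d₁₃ ; d₂₆ = d₁₅ ; d₄₆ = d₃₅
    ; c₁₂ = c₆₁ ; c₂₃ = c₁₂ ; c₃₄ = c₂₃ ; c₄₅ = c₃₄ ; c₅₆ = c₄₅ ; c₆₁ = c₅₆
    ; only = only′ ; size₁ = size₂ ; size₂ = size₁
    }
    where
    open SixJoin J
    only′ : ∀ u v → u ∈ X₂ → v ∈ X₁ → E G u v →
      (u ∈ A₆ × (v ∈ A₁ ⊎ v ∈ A₅)) ⊎ (u ∈ A₂ × (v ∈ A₁ ⊎ v ∈ A₃)) ⊎ (u ∈ A₄ × (v ∈ A₃ ⊎ v ∈ A₅))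
    only′ u v u∈X₂ v∈X₁ uv with only v u v∈X₁ u∈X₂ (E-sym uv)
    ... | inj₁ (v∈A₁ , inj₁ u∈A₂)        = inj₂ (inj₁ (u∈A₂ , inj₁ v∈A₁))
    ... | inj₁ (v∈A₁ , inj₂ u∈A₆)        = inj₁ (u∈A₆ , inj₁ v∈A₁)
    ... | inj₂ (inj₁ (v∈A₃ , inj₁ u∈A₂)) = inj₂ (inj₁ (u∈A₂ , inj₂ v∈A₃))
    ... | inj₂ (inj₁ (v∈A₃ , inj₂ u∈A₄)) = inj₂ (inj₂ (u∈A₄ , inj₁ v∈A₃))
    ... | inj₂ (inj₂ (v∈A₅ , inj₁ u∈A₄)) = inj₂ (inj₂ (u∈A₄ , inj₂ v∈A₅))
    ... | inj₂ (inj₂ (v∈A₅ , inj₂ u∈A₆)) = inj₁ (u∈A₆ , inj₂ v∈A₅)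

  -- shift^ k J renames A_i as A_(i+k), swapping X₁ and X₂ when k is odd; so the A₁ of
  -- shift^ k J is the A_(1−k) of J (indices mod 6).
  shift^ : ℕ → SixJoin G → SixJoin G
  shift^ zero    J = J
  shift^ (suc k) J = shift (shift^ k J)

  A₁₃₅ : SixJoin G → Subset n
  A₁₃₅ J = A₁ ∪ A₃ ∪ A₅ where open SixJoin J

  Y₁ : SixJoin G → Subset n
  Y₁ J = SixJoin.X₁ J ─ A₁₃₅ J

  A₁₃₅-shift² : (J : SixJoin G) → A₁₃₅ (shift^ 2 J) ≡ A₁₃₅ J
  A₁₃₅-shift² J = ∪-rotate A₅ A₁ A₃ where open SixJoin J

  A₁₃₅-shift⁴ : (J : SixJoin G) → A₁₃₅ (shift^ 4 J) ≡ A₁₃₅ J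
  A₁₃₅-shift⁴ J = trans (A₁₃₅-shift² (shift^ 2 J)) (A₁₃₅-shift² J)

  module _ (J : SixJoin G) where
    open SixJoin J

    X₁-X₂-distinct : u ∈ X₁ → v ∈ X₂ → u ≢ v
    X₁-X₂-distinct u∈X₁ v∈X₂ refl = disj _ u∈X₁ v∈X₂

    X₁-X₂-edge⇒A₁₃₅ : u ∈ X₁ → v ∈ X₂ → E G u v → u ∈ A₁₃₅ J
    X₁-X₂-edge⇒A₁₃₅ {u} {v} u∈X₁ v∈X₂ uv with only u v u∈X₁ v∈X₂ uv
    ... | inj₁ (u∈A₁ , _)        = x∈p∪q⁺ (inj₁ u∈A₁)
    ... | inj₂ (inj₁ (u∈A₃ , _)) = x∈p∪q⁺ (inj₂ (x∈p∪q⁺ (inj₁ u∈A₃)))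
    ... | inj₂ (inj₂ (u∈A₅ , _)) = x∈p∪q⁺ (inj₂ (x∈p∪q⁺ (inj₂ u∈A₅)))

    A₁-X₂-neighbour : u ∈ A₁ → v ∈ X₂ → E G u v → v ∈ A₂ ⊎ v ∈ A₆
    A₁-X₂-neighbour {u} {v} u∈A₁ v∈X₂ uv with only u v (A₁⊆ u∈A₁) v∈X₂ uv
    ... | inj₁ (_ , v∈A₂⊎A₆)     = v∈A₂⊎A₆
    ... | inj₂ (inj₁ (u∈A₃ , _)) = ⊥-elim (disjoint⇒∉ d₁₃ u∈A₁ u∈A₃)
    ... | inj₂ (inj₂ (u∈A₅ , _)) = ⊥-elim (disjoint⇒∉ d₁₅ u∈A₁ u∈A₅)

    A₁-A₄-nonadjacent : u ∈ A₁ → v ∈ A₄ → ¬ E G u v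
    A₁-A₄-nonadjacent u∈A₁ v∈A₄ uv =
      [ (λ v∈A₂ → disjoint⇒∉ d₂₄ v∈A₂ v∈A₄) , disjoint⇒∉ d₄₆ v∈A₄ ]′
        (A₁-X₂-neighbour u∈A₁ (A₄⊆ v∈A₄) uv)

  module _ (col : Fin n → Bool) (proper : ∀ u v → E G u v → col u ≢ col v) where

    common-neighbour⇒same-colour : E G a c → E G b c → col a ≡ col b
    common-neighbour⇒same-colour ac bc =
      trans (¬-not (proper _ _ ac)) (sym (¬-not (proper _ _ bc)))

    common-neighbour⇒¬E : E G a c → E G b c → ¬ E G a b
    common-neighbour⇒¬E ac bc ab = proper _ _ ab (common-neighbour⇒same-colour ac bc)

    square-isHole : E G a b → E G b c → E G c d → E G d a → a ≢ c → b ≢ d →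
      IsHole G ⊤ 4 (square a b c d)
    square-isHole {a} {b} {c} {d} ab bc cd da a≢c b≢d = record
      { length≥4 = ≤-refl ; inj = injective ; inS = λ _ → ∈⊤ ; chordless = chordless }
      where
      f : Fin 4 → Fin n
      f = square a b c d
      ¬ac : ¬ E G a c
      ¬ac = common-neighbour⇒¬E ab (E-sym bc)
      ¬bd : ¬ E G b d
      ¬bd = common-neighbour⇒¬E bc (E-sym cd)
      injective : ∀ {i j} → f i ≡ f j → i ≡ j
      injective {0F} {0F} _  = refl
      injective {0F} {1F} eq = ⊥-elim (E-irrefl ab eq)
      injective {0F} {2F} eq = ⊥-elim (a≢c eq)
      injective {0F} {3F} eq = ⊥-elim (E-irrefl da (sym eq))
      injective {1F} {0F} eq = ⊥-elim (E-irrefl ab (sym eq))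
      injective {1F} {1F} _  = refl
      injective {1F} {2F} eq = ⊥-elim (E-irrefl bc eq)
      injective {1F} {3F} eq = ⊥-elim (b≢d eq)
      injective {2F} {0F} eq = ⊥-elim (a≢c (sym eq))
      injective {2F} {1F} eq = ⊥-elim (E-irrefl bc (sym eq))
      injective {2F} {2F} _  = refl
      injective {2F} {3F} eq = ⊥-elim (E-irrefl cd eq)
      injective {3F} {0F} eq = ⊥-elim (E-irrefl da eq)
      injective {3F} {1F} eq = ⊥-elim (b≢d (sym eq))
      injective {3F} {2F} eq = ⊥-elim (E-irrefl cd (sym eq))
      injective {3F} {3F} _  = refl
      Consecutive : Fin 4 → Fin 4 → Set
      Consecutive i j = j ≡ cycSuc G i ⊎ i ≡ cycSuc G j
      edge : ∀ {i j} → E G (f i) (f j) → Consecutive i j → E G (f i) (f j) ⇔ Consecutive i j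
      edge e consecutive = mk⇔ (λ _ → consecutive) (λ _ → e)
      non-edge : ∀ {i j} → ¬ E G (f i) (f j) → ¬ Consecutive i j → E G (f i) (f j) ⇔ Consecutive i j
      non-edge ¬e ¬consecutive = mk⇔ (⊥-elim ∘ ¬e) (⊥-elim ∘ ¬consecutive)
      loop : ∀ {i} → ¬ E G (f i) (f i)
      loop e = E-irrefl e refl
      chordless : ∀ i j → E G (f i) (f j) ⇔ Consecutive i j
      chordless 0F 0F = non-edge loop λ { (inj₁ ()) ; (inj₂ ()) }
      chordless 0F 1F = edge ab (inj₁ refl)
      chordless 0F 2F = non-edge ¬ac λ { (inj₁ ()) ; (inj₂ ()) }
      chordless 0F 3F = edge (E-sym da) (inj₂ refl)
      chordless 1F 0F = edge (E-sym ab) (inj₂ refl)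
      chordless 1F 1F = non-edge loop λ { (inj₁ ()) ; (inj₂ ()) }
      chordless 1F 2F = edge bc (inj₁ refl)
      chordless 1F 3F = non-edge ¬bd λ { (inj₁ ()) ; (inj₂ ()) }
      chordless 2F 0F = non-edge (¬ac ∘ E-sym) λ { (inj₁ ()) ; (inj₂ ()) }
      chordless 2F 1F = edge (E-sym bc) (inj₂ refl)
      chordless 2F 2F = non-edge loop λ { (inj₁ ()) ; (inj₂ ()) }
      chordless 2F 3F = edge cd (inj₁ refl)
      chordless 3F 0F = edge da (inj₁ refl)
      chordless 3F 1F = non-edge (¬bd ∘ E-sym) λ { (inj₁ ()) ; (inj₂ ()) }
      chordless 3F 2F = edge (E-sym cd) (inj₂ refl)
      chordless 3F 3F = non-edge loop λ { (inj₁ ()) ; (inj₂ ()) }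

    common-neighbour∉N[] : FourHoleFree G ⊤ → E G a c → E G c b → a ≢ b → c ≢ x →
      a ∈N[ x ] → b ∈N[ x ] → ⊥
    common-neighbour∉N[] _  _  _  a≢b _   (inj₁ refl) (inj₁ refl) = a≢b refl
    common-neighbour∉N[] _  ac cb _   _   (inj₁ refl) (inj₂ ab)   =
      common-neighbour⇒¬E ac (E-sym cb) ab
    common-neighbour∉N[] _  ac cb _   _   (inj₂ ba)   (inj₁ refl) =
      common-neighbour⇒¬E ac (E-sym cb) (E-sym ba)
    common-neighbour∉N[] hf ac cb a≢b c≢x (inj₂ xa)   (inj₂ xb)   =
      hf _ (square-isHole xa ac cb (E-sym xb) (c≢x ∘ sym) a≢b)

    non-edge∉N[] : col a ≢ col b → ¬ E G a b → a ∈N[ x ] → b ∈N[ x ] → ⊥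
    non-edge∉N[] a≁b _   (inj₁ refl) (inj₁ refl) = a≁b refl
    non-edge∉N[] _   ¬ab (inj₁ refl) (inj₂ ab)   = ¬ab ab
    non-edge∉N[] _   ¬ab (inj₂ ba)   (inj₁ refl) = ¬ab (E-sym ba)
    non-edge∉N[] a≁b _   (inj₂ xa)   (inj₂ xb)   =
      a≁b (common-neighbour⇒same-colour (E-sym xa) (E-sym xb))

    -- If the star removes h₁, it removes none of h₃, h₄, h₅, so h₀ h₅ h₄ h₃ h₂ survives.
    hexagon-star-connected : FourHoleFree G ⊤ → (∀ r → r ∈ R → E G x r) →
      ∀ {h₀ h₁ h₂ h₃ h₄ h₅} →
      E G h₀ h₁ → E G h₁ h₂ → E G h₂ h₃ → E G h₃ h₄ → E G h₄ h₅ → E G h₅ h₀ →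
      ¬ E G h₁ h₄ → h₁ ≢ h₃ → h₁ ≢ h₅ → h₁ ∈ S → h₃ ∈ S → h₄ ∈ S → h₅ ∈ S →
      h₀ ∈ S ─ (⁅ x ⁆ ∪ R) → h₂ ∈ S ─ (⁅ x ⁆ ∪ R) → Reach G (S ─ (⁅ x ⁆ ∪ R)) h₀ h₂
    hexagon-star-connected {R} {x} {S} hf x-R {h₀} {h₁} {h₂} {h₃} {h₄} {h₅}
      e₀₁ e₁₂ e₂₃ e₃₄ e₄₅ e₅₀ ¬e₁₄ h₁≢h₃ h₁≢h₅ h₁∈S h₃∈S h₄∈S h₅∈S h₀∈T h₂∈T
      with h₁ ∈? S ─ (⁅ x ⁆ ∪ R)
    ... | yes h₁∈T = step (step (here h₀∈T) e₀₁ h₁∈T) e₁₂ h₂∈T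
    ... | no h₁∉T =
      step (step (step (step (here h₀∈T) (E-sym e₅₀) h₅∈T) (E-sym e₄₅) h₄∈T) (E-sym e₃₄) h₃∈T)
        (E-sym e₂₃) h₂∈T
      where
      h₁∈N[x] : h₁ ∈N[ x ]
      h₁∈N[x] = removed-by-star x-R h₁∈S h₁∉T
      survives : v ∈ S → (v ∈N[ x ] → ⊥) → v ∈ S ─ (⁅ x ⁆ ∪ R)
      survives {v} v∈S ∉N[x] =
        decidable-stable (v ∈? S ─ (⁅ x ⁆ ∪ R)) (∉N[x] ∘ removed-by-star x-R v∈S)
      survivor≢x : v ∈ S ─ (⁅ x ⁆ ∪ R) → v ≢ x
      survivor≢x v∈T = x∉⁅y⁆⇒x≢y (x∈p─q∪r⇒x∉q v∈T)
      h₃∈T : h₃ ∈ S ─ (⁅ x ⁆ ∪ R)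
      h₃∈T = survives h₃∈S
        (common-neighbour∉N[] hf e₁₂ e₂₃ h₁≢h₃ (survivor≢x h₂∈T) h₁∈N[x])
      h₅∈T : h₅ ∈ S ─ (⁅ x ⁆ ∪ R)
      h₅∈T = survives h₅∈S
        (common-neighbour∉N[] hf (E-sym e₀₁) (E-sym e₅₀) h₁≢h₅ (survivor≢x h₀∈T) h₁∈N[x])
      col₁≢col₄ : col h₁ ≢ col h₄
      col₁≢col₄ = proper _ _ e₃₄ ∘ trans (sym (common-neighbour⇒same-colour e₁₂ (E-sym e₂₃)))
      h₄∈T : h₄ ∈ S ─ (⁅ x ⁆ ∪ R)
      h₄∈T = survives h₄∈S (non-edge∉N[] col₁≢col₄ ¬e₁₄ h₁∈N[x])

    module SixJoin-properties (noCut : NoStarCutset G ⊤) where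

      module _ (J : SixJoin G) where
        open SixJoin J

        A₁-nonadjacent-A₁₃₅ : u ∈ A₁ → v ∈ A₁₃₅ J → ¬ E G u v
        A₁-nonadjacent-A₁₃₅ {u} {v} u∈A₁ = ∪-elim in-A₁ (∪-elim in-A₃ in-A₅)
          where
          a₂∈A₂ : proj₁ ne₂ ∈ A₂
          a₂∈A₂ = proj₂ ne₂
          a₆∈A₆ : proj₁ ne₆ ∈ A₆
          a₆∈A₆ = proj₂ ne₆
          in-A₁ : v ∈ A₁ → ¬ E G u v
          in-A₁ v∈A₁ = common-neighbour⇒¬E (c₁₂ _ _ u∈A₁ a₂∈A₂) (c₁₂ _ _ v∈A₁ a₂∈A₂)
          in-A₃ : v ∈ A₃ → ¬ E G u v
          in-A₃ v∈A₃ = common-neighbour⇒¬E (c₁₂ _ _ u∈A₁ a₂∈A₂) (E-sym (c₂₃ _ _ a₂∈A₂ v∈A₃))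
          in-A₅ : v ∈ A₅ → ¬ E G u v
          in-A₅ v∈A₅ = common-neighbour⇒¬E (E-sym (c₆₁ _ _ a₆∈A₆ u∈A₁)) (c₅₆ _ _ v∈A₅ a₆∈A₆)

        A₁-atMostOne-if-X₁⊆A₁₃₅ : X₁ ⊆ A₁₃₅ J → AtMostOne A₁
        A₁-atMostOne-if-X₁⊆A₁₃₅ X₁⊆A₁₃₅ {u} {u′} u∈A₁ u′∈A₁ =
          decidable-stable (u ≟ᶠ u′) λ u≢u′ →
            A₁-nonadjacent-A₁₃₅ u∈A₁ (x∈p∪q⁺ (inj₂ (x∈p∪q⁺ (inj₁ a₃∈A₃))))
              (dominated⇒adjacent noCut u≢u′ dominated
                (≢-sym (disjoint⇒≢ d₁₃ u∈A₁ a₃∈A₃)) (≢-sym (disjoint⇒≢ d₁₃ u′∈A₁ a₃∈A₃)))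
          where
          a₃∈A₃ : proj₁ ne₃ ∈ A₃
          a₃∈A₃ = proj₂ ne₃
          dominated : ∀ {z} → E G u′ z → E G u z
          dominated {z} u′z with cover z
          ... | inj₁ z∈X₁ = ⊥-elim (A₁-nonadjacent-A₁₃₅ u′∈A₁ (X₁⊆A₁₃₅ z∈X₁) u′z)
          ... | inj₂ z∈X₂ = [ c₁₂ u z u∈A₁ , (λ z∈A₆ → E-sym (c₆₁ z u z∈A₆ u∈A₁)) ]′
                              (A₁-X₂-neighbour J u′∈A₁ z∈X₂ u′z)

        A₁-atMostOne-if-FourHoleFree : FourHoleFree G ⊤ → AtMostOne A₁
        A₁-atMostOne-if-FourHoleFree hf {u} {u′} u∈A₁ u′∈A₁ =
          decidable-stable (u ≟ᶠ u′) λ u≢u′ →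
            hf _ (square-isHole (c₁₂ _ _ u∈A₁ a₂∈A₂) (E-sym (c₁₂ _ _ u′∈A₁ a₂∈A₂))
                    (E-sym (c₆₁ _ _ a₆∈A₆ u′∈A₁)) (c₆₁ _ _ a₆∈A₆ u∈A₁)
                    u≢u′ (disjoint⇒≢ d₂₆ a₂∈A₂ a₆∈A₆))
          where
          a₂∈A₂ : proj₁ ne₂ ∈ A₂
          a₂∈A₂ = proj₂ ne₂
          a₆∈A₆ : proj₁ ne₆ ∈ A₆
          a₆∈A₆ = proj₂ ne₆

        Y₁-reaches-A₁-neighbour : y ∈ Y₁ J →
          ¬ ¬ (Σ (Fin n) λ c → Reach G (Y₁ J) y c × Σ (Fin n) λ a → a ∈ A₁ × E G a c)
        Y₁-reaches-A₁-neighbour {y} y∈Y₁ no-neighbour =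
          star-nonseparating noCut a₄ (A₃ ∪ A₅) a₄-A₃∪A₅ y∈Rest a₁∈Rest λ y⇝a₁ →
            let (c , w , y⇝c , cw , w∈Rest , w∉Y₁) = Reach-exits y⇝a₁ y∈Y₁ a₁∉Y₁
            in no-neighbour (c , y⇝c , w , exit∈A₁ (Reach-target y⇝c) cw w∈Rest w∉Y₁ , E-sym cw)
          where
          a₁ a₄ : Fin n
          a₁ = proj₁ ne₁
          a₄ = proj₁ ne₄
          a₁∈A₁ : a₁ ∈ A₁
          a₁∈A₁ = proj₂ ne₁
          a₄∈A₄ : a₄ ∈ A₄
          a₄∈A₄ = proj₂ ne₄
          Rest : Subset n
          Rest = ⊤ ─ (⁅ a₄ ⁆ ∪ (A₃ ∪ A₅))
          a₄-A₃∪A₅ : ∀ r → r ∈ A₃ ∪ A₅ → E G a₄ r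
          a₄-A₃∪A₅ r = ∪-elim (λ r∈A₃ → E-sym (c₃₄ r a₄ r∈A₃ a₄∈A₄)) (c₄₅ a₄ r a₄∈A₄)
          y∈Rest : y ∈ Rest
          y∈Rest = x∈p─q∪r⁺ ∈⊤ (x≢y⇒x∉⁅y⁆ (X₁-X₂-distinct J (p─q⊆p _ _ y∈Y₁) (A₄⊆ a₄∈A₄)))
                  (x∈p─q∪r⇒x∉r y∈Y₁)
          a₁∈Rest : a₁ ∈ Rest
          a₁∈Rest = x∈p─q∪r⁺ ∈⊤ (x≢y⇒x∉⁅y⁆ (X₁-X₂-distinct J (A₁⊆ a₁∈A₁) (A₄⊆ a₄∈A₄)))
                   (∪-elim (disjoint⇒∉ d₁₃ a₁∈A₁) (disjoint⇒∉ d₁₅ a₁∈A₁))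
          a₁∉Y₁ : a₁ ∉ Y₁ J
          a₁∉Y₁ a₁∈Y₁ = x∈p─q∪r⇒x∉q a₁∈Y₁ a₁∈A₁
          exit∈A₁ : c ∈ Y₁ J → E G c w → w ∈ Rest → w ∉ Y₁ J → w ∈ A₁
          exit∈A₁ {c} {w} c∈Y₁ cw w∈Rest w∉Y₁ with cover w
          ... | inj₂ w∈X₂ =
            ⊥-elim (x∈p─q⇒x∉q c∈Y₁ (X₁-X₂-edge⇒A₁₃₅ J (p─q⊆p _ _ c∈Y₁) w∈X₂ cw))
          ... | inj₁ w∈X₁ =
            ∪-elim id (⊥-elim ∘ x∈p─q∪r⇒x∉r w∈Rest) (x∈p∧x∉p─q⇒x∈q w∈X₁ w∉Y₁)

      Y₁-nonempty : (J : SixJoin G) → Nonempty (Y₁ J)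
      Y₁-nonempty J = decidable-stable (nonempty? (Y₁ J)) λ Y₁-empty →
        <⇒≱ (s≤s (∣X₁∣≤3 (λ v∈X₁ → x∈p∧x∉p─q⇒x∈q v∈X₁ (λ v∈Y₁ → Y₁-empty (_ , v∈Y₁))))) size₁
        where
        open SixJoin J
        ∣X₁∣≤3 : X₁ ⊆ A₁₃₅ J → ∣ X₁ ∣ ≤ 3
        ∣X₁∣≤3 X₁⊆A₁₃₅ = begin
          ∣ X₁ ∣                       ≤⟨ p⊆q⇒∣p∣≤∣q∣ X₁⊆A₁₃₅ ⟩
          ∣ A₁ ∪ A₃ ∪ A₅ ∣             ≤⟨ ∣p∪q∣≤∣p∣+∣q∣ A₁ (A₃ ∪ A₅) ⟩
          ∣ A₁ ∣ + ∣ A₃ ∪ A₅ ∣         ≤⟨ +-monoʳ-≤ ∣ A₁ ∣ (∣p∪q∣≤∣p∣+∣q∣ A₃ A₅) ⟩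
          ∣ A₁ ∣ + (∣ A₃ ∣ + ∣ A₅ ∣)   ≡⟨ cong₂ _+_ (singleton J X₁⊆A₁₃₅)
                                           (cong₂ _+_ (singleton (shift^ 4 J) (transport (A₁₃₅-shift⁴ J)))
                                                      (singleton (shift^ 2 J) (transport (A₁₃₅-shift² J)))) ⟩
          3                            ∎
          where
          open ≤-Reasoning
          transport : ∀ {B} → B ≡ A₁₃₅ J → X₁ ⊆ B
          transport eq = subst (X₁ ⊆_) (sym eq) X₁⊆A₁₃₅
          singleton : ∀ J′ → SixJoin.X₁ J′ ⊆ A₁₃₅ J′ → ∣ SixJoin.A₁ J′ ∣ ≡ 1
          singleton J′ X₁⊆ = nonempty∧atMostOne⇒∣p∣≡1 (SixJoin.ne₁ J′) (A₁-atMostOne-if-X₁⊆A₁₃₅ J′ X₁⊆)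

      component-has-A₁-neighbour : (J : SixJoin G) → ∀ {C} →
        IsComponent G (Y₁ J) C → HasNbr (SixJoin.A₁ J) C
      component-has-A₁-neighbour J {C} component =
        decidable-stable (HasNbr? _ C) λ none →
          Y₁-reaches-A₁-neighbour J (sub y∈C) λ (c , y⇝c , a , a∈A₁ , ac) →
            none (a , c , a∈A₁ , closed _ c y∈C y⇝c , ac)
        where
        open IsComponent component
        y∈C : proj₁ nonempty ∈ C
        y∈C = proj₂ nonempty

      Y₁-has-A₁-neighbour : (J : SixJoin G) → HasNbr (SixJoin.A₁ J) (Y₁ J)
      Y₁-has-A₁-neighbour J =
        decidable-stable (HasNbr? _ _) λ none →
          Y₁-reaches-A₁-neighbour J (proj₂ (Y₁-nonempty J)) λ (c , y⇝c , a , a∈A₁ , ac) →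
            none (a , c , a∈A₁ , Reach-target y⇝c , ac)

      components-have-A₁₃₅-neighbours : (J : SixJoin G) → let open SixJoin J in
        ∀ C → IsComponent G (Y₁ J) C → HasNbr A₁ C × HasNbr A₃ C × HasNbr A₅ C
      components-have-A₁₃₅-neighbours J C component =
          component-has-A₁-neighbour J component
        , component-has-A₁-neighbour (shift^ 4 J) (transport (A₁₃₅-shift⁴ J))
        , component-has-A₁-neighbour (shift^ 2 J) (transport (A₁₃₅-shift² J))
        where
        transport : ∀ {B} → B ≡ A₁₃₅ J → IsComponent G (SixJoin.X₁ J ─ B) C
        transport eq = subst (λ B → IsComponent G (SixJoin.X₁ J ─ B) C) (sym eq) component

      A₁-atMostOne-if-MaxDeg≤3 : (J : SixJoin G) → MaxDeg≤ G 3 → AtMostOne (SixJoin.A₁ J)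
      A₁-atMostOne-if-MaxDeg≤3 J maxDeg {u} {u′} u∈A₁ u′∈A₁ =
        decidable-stable (u ≟ᶠ u′) λ u≢u′ → too-many-neighbours u≢u′ (Y₁-has-A₁-neighbour (shift J))
        where
        open SixJoin J
        a₅∈A₅ : proj₁ ne₅ ∈ A₅
        a₅∈A₅ = proj₂ ne₅
        too-many-neighbours : u ≢ u′ → HasNbr A₆ (Y₁ (shift J)) → ⊥
        too-many-neighbours u≢u′ (b , c , b∈A₆ , c∈Y₂ , bc) =
          <⇒≱ (s≤s (maxDeg b))
            (Unique∧All∈⇒length≤∣p∣
              ( (u≢u′ ∷ disjoint⇒≢ d₁₅ u∈A₁ a₅∈A₅ ∷ ≢c (A₁⊆ u∈A₁) ∷ [])
              ∷ (disjoint⇒≢ d₁₅ u′∈A₁ a₅∈A₅ ∷ ≢c (A₁⊆ u′∈A₁) ∷ [])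
              ∷ (≢c (A₅⊆ a₅∈A₅) ∷ [])
              ∷ [] ∷ [])
              ( E⇒∈N (c₆₁ _ _ b∈A₆ u∈A₁) ∷ E⇒∈N (c₆₁ _ _ b∈A₆ u′∈A₁)
              ∷ E⇒∈N (E-sym (c₅₆ _ _ a₅∈A₅ b∈A₆)) ∷ E⇒∈N bc ∷ []))
          where
          ≢c : v ∈ X₁ → v ≢ c
          ≢c v∈X₁ = X₁-X₂-distinct J v∈X₁ (p─q⊆p _ _ c∈Y₂)

      A₁-atMostOne : (J : SixJoin G) → FourHoleFree G ⊤ ⊎ MaxDeg≤ G 3 → AtMostOne (SixJoin.A₁ J)
      A₁-atMostOne J = [ A₁-atMostOne-if-FourHoleFree J , A₁-atMostOne-if-MaxDeg≤3 J ]′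

      A₁-deg≥3 : (J : SixJoin G) → FourHoleFree G ⊤ ⊎ MaxDeg≤ G 3 →
        ∀ {v} → v ∈ SixJoin.A₁ J → 3 ≤ deg G v
      A₁-deg≥3 J sparse {v} v∈A₁ = three-neighbours (Y₁-has-A₁-neighbour J)
        where
        open SixJoin J
        a₂∈A₂ : proj₁ ne₂ ∈ A₂
        a₂∈A₂ = proj₂ ne₂
        a₆∈A₆ : proj₁ ne₆ ∈ A₆
        a₆∈A₆ = proj₂ ne₆
        three-neighbours : HasNbr A₁ (Y₁ J) → 3 ≤ deg G v
        three-neighbours (b , c , b∈A₁ , c∈Y₁ , bc) =
          Unique∧All∈⇒length≤∣p∣
            ( (disjoint⇒≢ d₂₆ a₂∈A₂ a₆∈A₆ ∷ ≢c (A₂⊆ a₂∈A₂) ∷ [])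
            ∷ (≢c (A₆⊆ a₆∈A₆) ∷ [])
            ∷ [] ∷ [])
            ( E⇒∈N (c₁₂ _ _ v∈A₁ a₂∈A₂) ∷ E⇒∈N (E-sym (c₆₁ _ _ a₆∈A₆ v∈A₁))
            ∷ E⇒∈N (subst (λ b → E G b c) (A₁-atMostOne J sparse b∈A₁ v∈A₁) bc) ∷ [])
          where
          ≢c : w ∈ X₂ → w ≢ c
          ≢c w∈X₂ = ≢-sym (X₁-X₂-distinct J (p─q⊆p _ _ c∈Y₁) w∈X₂)

      A₂-A₄-star-connected : (J : SixJoin G) → FourHoleFree G ⊤ → (∀ r → r ∈ R → E G x r) →
        let open SixJoin J in
        ∀ {a₂ a₄ a₆} → X₁ ⊆ S → a₆ ∈ A₆ → a₆ ∈ S → a₂ ∈ A₂ → a₄ ∈ A₄ →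
        a₂ ∈ S ─ (⁅ x ⁆ ∪ R) → a₄ ∈ S ─ (⁅ x ⁆ ∪ R) → Reach G (S ─ (⁅ x ⁆ ∪ R)) a₂ a₄
      A₂-A₄-star-connected J hf x-R X₁⊆S a₆∈A₆ a₆∈S a₂∈A₂ a₄∈A₄ =
        hexagon-star-connected hf x-R
          (c₂₃ _ _ a₂∈A₂ a₃∈A₃) (c₃₄ _ _ a₃∈A₃ a₄∈A₄) (c₄₅ _ _ a₄∈A₄ a₅∈A₅) (c₅₆ _ _ a₅∈A₅ a₆∈A₆)
          (c₆₁ _ _ a₆∈A₆ a₁∈A₁) (c₁₂ _ _ a₁∈A₁ a₂∈A₂)
          (A₁-A₄-nonadjacent (shift^ 4 J) a₃∈A₃ a₆∈A₆)
          (disjoint⇒≢ d₃₅ a₃∈A₃ a₅∈A₅) (≢-sym (disjoint⇒≢ d₁₃ a₁∈A₁ a₃∈A₃))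
          (X₁⊆S (A₃⊆ a₃∈A₃)) (X₁⊆S (A₅⊆ a₅∈A₅)) a₆∈S (X₁⊆S (A₁⊆ a₁∈A₁))
        where
        open SixJoin J
        a₁∈A₁ : proj₁ ne₁ ∈ A₁
        a₁∈A₁ = proj₂ ne₁
        a₃∈A₃ : proj₁ ne₃ ∈ A₃
        a₃∈A₃ = proj₂ ne₃
        a₅∈A₅ : proj₁ ne₅ ∈ A₅
        a₅∈A₅ = proj₂ ne₅

      module _ (J : SixJoin G) (hf : FourHoleFree G ⊤) {a₂ a₄ a₆ : Fin n}
               (a₂∈A₂ : a₂ ∈ SixJoin.A₂ J) (a₄∈A₄ : a₄ ∈ SixJoin.A₄ J) (a₆∈A₆ : a₆ ∈ SixJoin.A₆ J)
               where
        open SixJoin J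

        Q V₁ : Subset n
        Q = ⁅ a₂ ⁆ ∪ ⁅ a₄ ⁆ ∪ ⁅ a₆ ⁆
        V₁ = block G X₁ a₂ a₄ a₆

        a₂∈Q : a₂ ∈ Q
        a₂∈Q = x∈p∪q⁺ (inj₁ (x∈⁅x⁆ a₂))
        a₄∈Q : a₄ ∈ Q
        a₄∈Q = x∈p∪q⁺ (inj₂ (x∈p∪q⁺ (inj₁ (x∈⁅x⁆ a₄))))
        a₆∈Q : a₆ ∈ Q
        a₆∈Q = x∈p∪q⁺ (inj₂ (x∈p∪q⁺ (inj₂ (x∈⁅x⁆ a₆))))

        X₁⊆V₁ : X₁ ⊆ V₁
        X₁⊆V₁ = x∈p∪q⁺ ∘ inj₁
        Q⊆V₁ : Q ⊆ V₁
        Q⊆V₁ = x∈p∪q⁺ ∘ inj₂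

        block-exits-through-Q : w ∈ V₁ → w′ ∉ V₁ → E G w w′ → w ∈ Q
        block-exits-through-Q {w} {w′} w∈ w′∉ ww′ =
          ∪-elim (λ w∈X₁ → ⊥-elim (w′∉ (w′∈V₁ w∈X₁))) id w∈
          where
          only-vertex : ∀ k {a} → a ∈ SixJoin.A₁ (shift^ k J) → a ∈ Q →
            w′ ∈ SixJoin.A₁ (shift^ k J) → w′ ∈ Q
          only-vertex k a∈ a∈Q w′∈ =
            subst (_∈ Q) (A₁-atMostOne (shift^ k J) (inj₁ hf) a∈ w′∈) a∈Q
          A₂₄₆⊆Q : w′ ∈ A₆ ∪ A₂ ∪ A₄ → w′ ∈ Q
          A₂₄₆⊆Q = ∪-elim (only-vertex 1 a₆∈A₆ a₆∈Q)
                     (∪-elim (only-vertex 5 a₂∈A₂ a₂∈Q) (only-vertex 3 a₄∈A₄ a₄∈Q))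
          w′∈V₁ : w ∈ X₁ → w′ ∈ V₁
          w′∈V₁ w∈X₁ with cover w′
          ... | inj₁ w′∈X₁ = X₁⊆V₁ w′∈X₁
          ... | inj₂ w′∈X₂ = Q⊆V₁ (A₂₄₆⊆Q (X₁-X₂-edge⇒A₁₃₅ (shift J) w′∈X₂ w∈X₁ (E-sym ww′)))

        Q-star-connected : (∀ r → r ∈ R → E G x r) →
          ∀ {q q′} → q ∈ Q → q′ ∈ Q →
          q ∈ V₁ ─ (⁅ x ⁆ ∪ R) → q′ ∈ V₁ ─ (⁅ x ⁆ ∪ R) → Reach G (V₁ ─ (⁅ x ⁆ ∪ R)) q q′
        Q-star-connected {R} {x} x-R q∈Q q′∈Q = connected (Q⁻ q∈Q) (Q⁻ q′∈Q)
          where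
          Rest : Subset n
          Rest = V₁ ─ (⁅ x ⁆ ∪ R)
          Q⁻ : w ∈ Q → w ≡ a₂ ⊎ w ≡ a₄ ⊎ w ≡ a₆
          Q⁻ = ∪-elim (inj₁ ∘ x∈⁅y⁆⇒x≡y a₂)
                 (∪-elim (inj₂ ∘ inj₁ ∘ x∈⁅y⁆⇒x≡y a₄) (inj₂ ∘ inj₂ ∘ x∈⁅y⁆⇒x≡y a₆))
          a₂⇝a₄ : a₂ ∈ Rest → a₄ ∈ Rest → Reach G Rest a₂ a₄
          a₂⇝a₄ = A₂-A₄-star-connected J hf x-R X₁⊆V₁ a₆∈A₆ (Q⊆V₁ a₆∈Q) a₂∈A₂ a₄∈A₄
          a₄⇝a₆ : a₄ ∈ Rest → a₆ ∈ Rest → Reach G Rest a₄ a₆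
          a₄⇝a₆ = A₂-A₄-star-connected (shift^ 4 J) hf x-R X₁⊆V₁ a₂∈A₂ (Q⊆V₁ a₂∈Q) a₄∈A₄ a₆∈A₆
          a₆⇝a₂ : a₆ ∈ Rest → a₂ ∈ Rest → Reach G Rest a₆ a₂
          a₆⇝a₂ = A₂-A₄-star-connected (shift^ 2 J) hf x-R X₁⊆V₁ a₄∈A₄ (Q⊆V₁ a₄∈Q) a₆∈A₆ a₂∈A₂
          connected : ∀ {q q′} → q ≡ a₂ ⊎ q ≡ a₄ ⊎ q ≡ a₆ → q′ ≡ a₂ ⊎ q′ ≡ a₄ ⊎ q′ ≡ a₆ →
            q ∈ Rest → q′ ∈ Rest → Reach G Rest q q′
          connected (inj₁ refl)        (inj₁ refl)        q∈ _   = here q∈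
          connected (inj₁ refl)        (inj₂ (inj₁ refl))        = a₂⇝a₄
          connected (inj₁ refl)        (inj₂ (inj₂ refl)) q∈ q′∈ = Reach-sym (a₆⇝a₂ q′∈ q∈)
          connected (inj₂ (inj₁ refl)) (inj₁ refl)        q∈ q′∈ = Reach-sym (a₂⇝a₄ q′∈ q∈)
          connected (inj₂ (inj₁ refl)) (inj₂ (inj₁ refl)) q∈ _   = here q∈
          connected (inj₂ (inj₁ refl)) (inj₂ (inj₂ refl))        = a₄⇝a₆
          connected (inj₂ (inj₂ refl)) (inj₁ refl)               = a₆⇝a₂
          connected (inj₂ (inj₂ refl)) (inj₂ (inj₁ refl)) q∈ q′∈ = Reach-sym (a₄⇝a₆ q′∈ q∈)
          connected (inj₂ (inj₂ refl)) (inj₂ (inj₂ refl)) q∈ _   = here q∈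

        block-noStarCutset : NoStarCutset G V₁
        block-noStarCutset (x , R , _ , _ , x-R , u , v , u∈ , v∈ , disconnected) =
          star-nonseparating noCut x R x-R (x∈p∧x∈q─r⇒x∈p─r ∈⊤ u∈) (x∈p∧x∈q─r⇒x∈p─r ∈⊤ v∈) λ u⇝v →
            disconnected (Reach-restrict block-exits-through-Q
                            (Q-star-connected x-R) u⇝v u∈ (p─q⊆p _ _ v∈))

lemma3p2 : ∀ {n} (G : Graph n) → Bipartite G → NoStarCutset G ⊤ →
  (J : SixJoin G) →
  let open SixJoin J
      Y₁ = X₁ ─ (A₁ ∪ A₃ ∪ A₅)
      Y₂ = X₂ ─ (A₂ ∪ A₄ ∪ A₆)
      HasNbr = λ (A C : Subset n) →
        Σ (Fin n) λ a → Σ (Fin n) λ c → a ∈ A × c ∈ C × E G a c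
  in
  -- (i)
  (Nonempty Y₁ × Nonempty Y₂)
  -- (ii)
  × (∀ C → IsComponent G Y₁ C → HasNbr A₁ C × HasNbr A₃ C × HasNbr A₅ C)
  × (∀ C → IsComponent G Y₂ C → HasNbr A₂ C × HasNbr A₄ C × HasNbr A₆ C)
  -- (iii)
  × ((FourHoleFree G ⊤ ⊎ MaxDeg≤ G 3) →
      (Singleton G A₁ × Singleton G A₂ × Singleton G A₃
        × Singleton G A₄ × Singleton G A₅ × Singleton G A₆)
      × (∀ v → v ∈ A₁ ∪ A₂ ∪ A₃ ∪ A₄ ∪ A₅ ∪ A₆ → 3 ≤ deg G v))
  -- (iv)
  × (Balanceable G ⊤ →
      ∀ a₁ a₂ a₃ a₄ a₅ a₆ → a₁ ∈ A₁ → a₂ ∈ A₂ → a₃ ∈ A₃ → a₄ ∈ A₄ →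
      a₅ ∈ A₅ → a₆ ∈ A₆ →
      Balanceable G (block G X₁ a₂ a₄ a₆)
      × Balanceable G (block G X₂ a₁ a₃ a₅))
  -- (v)
  × (FourHoleFree G ⊤ →
      ∀ a₁ a₂ a₃ a₄ a₅ a₆ → a₁ ∈ A₁ → a₂ ∈ A₂ → a₃ ∈ A₃ → a₄ ∈ A₄ →
      a₅ ∈ A₅ → a₆ ∈ A₆ →
      NoStarCutset G (block G X₁ a₂ a₄ a₆)
      × NoStarCutset G (block G X₂ a₁ a₃ a₅))
lemma3p2 G (col , proper) noCut J =
    (Y₁-nonempty J , Y₁-nonempty (rotated 5))
  , components-have-A₁₃₅-neighbours J
  , components-have-A₁₃₅-neighbours (rotated 5)
  , (λ sparse →
        ( singleton sparse 0 , singleton sparse 5 , singleton sparse 4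
        , singleton sparse 3 , singleton sparse 2 , singleton sparse 1 )
      , λ _ → ∪-elim (deg≥3 sparse 0) (∪-elim (deg≥3 sparse 5) (∪-elim (deg≥3 sparse 4)
                (∪-elim (deg≥3 sparse 3) (∪-elim (deg≥3 sparse 2) (deg≥3 sparse 1))))))
  , (λ balanced _ _ _ _ _ _ _ _ _ _ _ _ →
        Balanceable-restrict G balanced , Balanceable-restrict G balanced)
  , λ hf _ _ _ _ _ _ a₁∈A₁ a₂∈A₂ a₃∈A₃ a₄∈A₄ a₅∈A₅ a₆∈A₆ →
        block-noStarCutset J hf a₂∈A₂ a₄∈A₄ a₆∈A₆
      , block-noStarCutset (rotated 1) hf a₁∈A₁ a₃∈A₃ a₅∈A₅
  where
  open SixJoin-properties G col proper noCut
  rotated : ℕ → SixJoin G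
  rotated k = shift^ G k J
  singleton : FourHoleFree G ⊤ ⊎ MaxDeg≤ G 3 → ∀ k → Singleton G (SixJoin.A₁ (rotated k))
  singleton sparse k = nonempty∧atMostOne⇒∣p∣≡1 (SixJoin.ne₁ (rotated k)) (A₁-atMostOne (rotated k) sparse)
  deg≥3 : FourHoleFree G ⊤ ⊎ MaxDeg≤ G 3 → ∀ k {v} → v ∈ SixJoin.A₁ (rotated k) → 3 ≤ deg G v
  deg≥3 sparse k = A₁-deg≥3 (rotated k) sparse
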